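{- Let $\Omega$ be a finite set of size $n$ and let $1\le r\le n$. Then $\mathcal{U}_{r,\Omega}$ is a domination hypergraph if and only if $r=1$, or $r=n$, or ($r=2$ and $n$ is even). Moreover: (1) the complete graph $K_\Omega$ is the unique graph $G$ with $\mathcal{U}_{1,\Omega}=\mathcal{D}(G)$; (2) the empty graph $\overline{K_\Omega}$ is the unique graph $G$ with $\mathcal{U}_{n,\Omega}=\mathcal{D}(G)$; (3) if $n=2m$, then there are exactly $(2m)!/(2^m m!)$ graphs $G$ with $\mathcal{U}_{2,\Omega}=\mathcal{D}(G)$, namely the graphs of the form $G=\overline{K_{\Omega_1}}\vee\cdots\vee\overline{K_{\Omega_m}}$ where $\Omega=\Omega_1\cup\cdots\cup\Omega_m$ is a partition with $|\Omega_i|=2$ for all $i$ (equivalently, $K_\Omega$ with the edges of a perfect matching deleted).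
   Context: Graphs are finite, simple, undirected. A dominating set of a graph $G$ is a set $D\subseteq V(G)$ such that every vertex not in $D$ is adjacent to some vertex of $D$; $\mathcal{D}(G)$ denotes the family of inclusion-minimal dominating sets of $G$. A hypergraph on a finite set $\Omega$ is a nonempty family of nonempty subsets of $\Omega$ none of which is a proper subset of another. A hypergraph $\mathcal{H}$ is a domination hypergraph if $\mathcal{H}=\mathcal{D}(G)$ for some graph $G$. $\mathcal{U}_{r,\Omega}=\{A\subseteq\Omega: |A|=r\}$. $K_\Omega$ is the complete graph and $\overline{K_\Omega}$ the edgeless graph on vertex set $\Omega$. The join $G_1\vee\cdots\vee G_m$ of graphs with pairwise disjoint vertex sets has vertex set $\bigcup V(G_i)$ and edges $\bigcup E(G_i)$ together with all pairs $\{x,y\}$ with $x,y$ in different $V(G_i)$. Graphs $G$ in the statement have vertex set $\Omega$. -}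

module Defs where

open import Data.Nat using (ℕ; suc; _≤_; _*_; _^_; _!)
open import Data.Nat.Divisibility using (_∣_)
open import Data.Fin using (Fin)
open import Data.Fin.Subset using (Subset; _∈_; _⊆_; ∣_∣)
open import Data.Bool using (Bool; true; false)
open import Data.Product using (Σ; ∃; _×_)
open import Data.Sum using (_⊎_)
open import Data.List using (List; length)
open import Data.List.Membership.Propositional using () renaming (_∈_ to _∈ₗ_)
open import Data.List.Relation.Unary.All using (All)
open import Data.List.Relation.Unary.Any using (Any)
open import Data.List.Relation.Unary.AllPairs using (AllPairs)
open import Relation.Nullary using (¬_)
open import Relation.Binary.PropositionalEquality using (_≡_; _≢_)
open import Function.Bundles using (_⇔_)

record Graph (n : ℕ) : Set where
  field
    adj     : Fin n → Fin n → Bool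
    adj-sym : ∀ x y → adj x y ≡ adj y x
    adj-irr : ∀ x → adj x x ≡ false
open Graph public

_≈G_ : ∀ {n} → Graph n → Graph n → Set
G ≈G H = ∀ x y → adj G x y ≡ adj H x y

Family : ℕ → Set₁
Family n = Subset n → Set

Dominating : ∀ {n} → Graph n → Subset n → Set
Dominating {n} G D = ∀ (v : Fin n) → v ∈ D ⊎ ∃ λ u → u ∈ D × adj G u v ≡ true

MinDominating : ∀ {n} → Graph n → Subset n → Set
MinDominating G D = Dominating G D × (∀ T → T ⊆ D → Dominating G T → T ≡ D)

_≡Fam_ : ∀ {n} → Family n → Family n → Set
H ≡Fam K = ∀ S → H S ⇔ K S

𝒟 : ∀ {n} → Graph n → Family n
𝒟 G = MinDominating G

𝒰 : ∀ {n} → ℕ → Family n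
𝒰 r S = ∣ S ∣ ≡ r

IsDominationHypergraph : ∀ {n} → Family n → Set
IsDominationHypergraph {n} H = Σ (Graph n) λ G → H ≡Fam 𝒟 G

IsComplete : ∀ {n} → Graph n → Set
IsComplete G = ∀ x y → (adj G x y ≡ true ⇔ x ≢ y)

IsEdgeless : ∀ {n} → Graph n → Set
IsEdgeless G = ∀ x y → adj G x y ≡ false

-- G = join of edgeless graphs on the blocks {x, σ x} of a partition of Ω into
-- 2-element sets, the partition given by a fixed-point-free involution σ.
-- Two vertices are adjacent iff they lie in different blocks.
IsJoinOfPairs : ∀ {n} → Graph n → Set
IsJoinOfPairs {n} G =
  Σ (Fin n → Fin n) λ σ →
    (∀ x → σ (σ x) ≡ x) × (∀ x → σ x ≢ x) ×
    (∀ x y → (adj G x y ≡ true ⇔ (x ≢ y × y ≢ σ x)))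

ExactlyGraphs : ∀ {n} → ℕ → (Graph n → Set) → Set
ExactlyGraphs {n} k P =
  Σ (List (Graph n)) λ Gs →
    length Gs ≡ k × All P Gs × AllPairs (λ G H → ¬ (G ≈G H)) Gs ×
    (∀ G → P G → Any (λ H → G ≈G H) Gs)

-- 𝒰 r = 𝒟 G says exactly that every r-set dominates G and no smaller set does. Then every
-- (r - 1)-set T misses some vertex w, so T lies in the non-neighbourhood of w, which has fewer
-- than r elements: T is the whole non-neighbourhood of w. For r = 2 this makes the unique
-- non-neighbour σ x of x a fixed-point-free involution whose pairs are exactly the non-edges, so
-- G is K_Ω minus a perfect matching and n is even. For 3 ≤ r < n, a non-neighbourhood S of v of
-- size r - 1 makes S ∪ {v} closed under non-neighbours, yet an (r - 1)-set through v and a vertex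
-- outside S ∪ {v} is again a non-neighbourhood of a vertex of S, a contradiction. Perfect
-- matchings of Fin 2m are listed by choosing the partner of the first vertex and recursing, which
-- gives (2m - 1)!! = (2m)! / (2^m m!) of them.

module Submission where

open import Defs
open import Data.Nat using (ℕ; zero; suc; _+_; _*_; _^_; _!; _≤_; _<_; z≤n; s≤s; _<?_)
open import Data.Nat.Divisibility using (_∣_; divides; ∣-refl; ∣m∣n⇒∣m+n)
open import Data.Nat.Properties
  using (≤-refl; ≤-trans; ≤-reflexive; ≤-pred; <-irrefl; <-≤-trans; <⇒≤; ≤∧≢⇒<; ≮⇒≥; n≤1+n; m<m+n;
         suc-injective; +-suc; +-identityʳ; *-comm; *-suc)
  renaming (_≟_ to _≟ℕ_)
open import Data.Nat.Tactic.RingSolver using (solve-∀)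
open import Data.Fin using (Fin; zero; suc; punchIn; punchOut)
open import Data.Fin.Properties
  using (_≟_; any?; all?; ¬∀⟶∃¬; punchIn-injective; punchInᵢ≢i; punchIn-punchOut; punchOut-punchIn; punchOut-cong)
import Data.Fin.Properties as Fin
open import Data.Fin.Subset using (Subset; _∈_; _∉_; _⊆_; ∣_∣; ⁅_⁆; _∪_; _-_; ⊤; ⊥; Nonempty)
open import Data.Fin.Subset.Properties
  using (_∈?_; s⊆s; out⊆; p⊆q⇒∣p∣≤∣q∣; ⊆-antisym; p─q⊆p; x∈p∧x≢y⇒x∈p-y; x∈p⇒∣p-x∣<∣p∣;
         x∈p∪q⁺; x∈⁅x⁆; x∈⁅y⁆⇒x≡y; x∉⁅y⁆⇒x≢y; ∣⁅x⁆∣≡1; p─⊥≡p; ⊥⊆; ∣⊥∣≡0; ∪-identityʳ; drop-there;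
         ∈⊤; ∣⊤∣≡n; ∣p∣≡n⇒p≡⊤)
open import Data.Vec using ([]; _∷_; here; there)
import Data.Vec as Vec
open import Data.Vec.Properties using (lookup∘tabulate; []=⇒lookup; lookup⇒[]=)
open import Data.List using (List; []; _∷_; _++_; map; concat; tabulate; length)
open import Data.List.Properties using (length-++; length-map)
open import Data.List.Relation.Unary.All using (All)
import Data.List.Relation.Unary.All as All
import Data.List.Relation.Unary.All.Properties as All
open import Data.List.Relation.Unary.Any using (Any; here)
import Data.List.Relation.Unary.Any as Any
import Data.List.Relation.Unary.Any.Properties as Any
open import Data.List.Relation.Unary.AllPairs using (AllPairs; []; _∷_)
import Data.List.Relation.Unary.AllPairs as AllPairs
import Data.List.Relation.Unary.AllPairs.Properties as AllPairs
open import Data.Bool using (Bool; true; false)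
open import Data.Bool.Properties using (¬-not) renaming (_≟_ to _≟ᵇ_)
open import Data.Product using (Σ; ∃; _×_; _,_; proj₁; proj₂)
open import Data.Sum using (_⊎_; inj₁; inj₂)
open import Function using (id; _∘_)
open import Function.Bundles using (_⇔_; mk⇔; Equivalence)
open import Relation.Nullary using (¬_; Dec; yes; no; does; contradiction)
open import Relation.Nullary.Decidable using (_⊎-dec_; _×-dec_; ¬?; dec-true; dec-false)
open import Level using (0ℓ)
open import Relation.Unary using (Pred; Decidable)
open import Relation.Binary.PropositionalEquality
  using (_≡_; _≢_; _≗_; refl; sym; trans; cong; cong₂; subst; module ≡-Reasoning)
open ≡-Reasoning

private
  variable
    n : ℕ

subsetOf : {P : Pred (Fin n) 0ℓ} → Decidable P → Subset n
subsetOf P? = Vec.tabulate (does ∘ P?)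

∈-subsetOf : {P : Pred (Fin n) 0ℓ} (P? : Decidable P) {x : Fin n} → x ∈ subsetOf P? ⇔ P x
∈-subsetOf P? {x} = mk⇔
  (λ x∈ → witness (P? x) (trans (sym (lookup∘tabulate (does ∘ P?) x)) ([]=⇒lookup x∈)))
  (λ Px → lookup⇒[]= x _ (trans (lookup∘tabulate (does ∘ P?) x) (dec-true (P? x) Px)))
  where
  witness : ∀ {A : Set} (A? : Dec A) → does A? ≡ true → A
  witness (yes a) _ = a
  witness (no _) ()

x∈p-y⇒x≢y : {x y : Fin n} {p : Subset n} → x ∈ p - y → x ≢ y
x∈p-y⇒x≢y {x = zero}  {p = _ ∷ _} () refl
x∈p-y⇒x≢y {x = suc x} {p = _ ∷ p} (there x∈p-y) refl = x∈p-y⇒x≢y {p = p} x∈p-y refl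

x∈p⇒0<∣p∣ : {x : Fin n} {p : Subset n} → x ∈ p → 0 < ∣ p ∣
x∈p⇒0<∣p∣ x∈p = ≤-trans (s≤s z≤n) (x∈p⇒∣p-x∣<∣p∣ x∈p)

0<∣p∣⇒Nonempty : (p : Subset n) → 0 < ∣ p ∣ → Nonempty p
0<∣p∣⇒Nonempty (true ∷ p)  _     = zero , here
0<∣p∣⇒Nonempty (false ∷ p) 0<∣p∣ with 0<∣p∣⇒Nonempty p 0<∣p∣
... | x , x∈p = suc x , there x∈p

⊆∧∣q∣≤∣p∣⇒p≡q : {p q : Subset n} → p ⊆ q → ∣ q ∣ ≤ ∣ p ∣ → p ≡ q
⊆∧∣q∣≤∣p∣⇒p≡q {p = p} {q} p⊆q ∣q∣≤∣p∣ = ⊆-antisym p⊆q q⊆p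
  where
  q⊆p : q ⊆ p
  q⊆p {x} x∈q with x ∈? p
  ... | yes x∈p = x∈p
  ... | no  x∉p = contradiction (≤-trans (s≤s ∣p∣≤∣q-x∣) (≤-trans (x∈p⇒∣p-x∣<∣p∣ x∈q) ∣q∣≤∣p∣)) (<-irrefl refl)
    where
    ∣p∣≤∣q-x∣ : ∣ p ∣ ≤ ∣ q - x ∣
    ∣p∣≤∣q-x∣ = p⊆q⇒∣p∣≤∣q∣ {p = p} {q - x} λ y∈p → x∈p∧x≢y⇒x∈p-y {p = q} (p⊆q y∈p) λ { refl → x∉p y∈p }

∃⊆-of-size : ∀ k (p : Subset n) → k ≤ ∣ p ∣ → ∃ λ t → t ⊆ p × ∣ t ∣ ≡ k
∃⊆-of-size {n} zero p _ = ⊥ , ⊥⊆ , ∣⊥∣≡0 n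
∃⊆-of-size (suc k) (true ∷ p)  (s≤s k≤) with ∃⊆-of-size k p k≤
... | t , t⊆p , ∣t∣≡k = true ∷ t , s⊆s t⊆p , cong suc ∣t∣≡k
∃⊆-of-size (suc k) (false ∷ p) k<       with ∃⊆-of-size (suc k) p k<
... | t , t⊆p , ∣t∣≡k = false ∷ t , out⊆ t⊆p , ∣t∣≡k

x∈p⇒suc∣p-x∣≡∣p∣ : {x : Fin n} {p : Subset n} → x ∈ p → suc ∣ p - x ∣ ≡ ∣ p ∣
x∈p⇒suc∣p-x∣≡∣p∣ {p = true ∷ p}  here      = cong (suc ∘ ∣_∣) (p─⊥≡p p)
x∈p⇒suc∣p-x∣≡∣p∣ {p = true ∷ p}  (there x∈p) = cong suc (x∈p⇒suc∣p-x∣≡∣p∣ x∈p)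
x∈p⇒suc∣p-x∣≡∣p∣ {p = false ∷ p} (there x∈p) = x∈p⇒suc∣p-x∣≡∣p∣ x∈p

x∉p⇒∣p∪⁅x⁆∣≡suc∣p∣ : {x : Fin n} {p : Subset n} → x ∉ p → ∣ p ∪ ⁅ x ⁆ ∣ ≡ suc ∣ p ∣
x∉p⇒∣p∪⁅x⁆∣≡suc∣p∣ {x = zero}  {true ∷ p}  x∉p = contradiction here x∉p
x∉p⇒∣p∪⁅x⁆∣≡suc∣p∣ {x = zero}  {false ∷ p} _   = cong (suc ∘ ∣_∣) (∪-identityʳ p)
x∉p⇒∣p∪⁅x⁆∣≡suc∣p∣ {x = suc x} {true ∷ p}  x∉p = cong suc (x∉p⇒∣p∪⁅x⁆∣≡suc∣p∣ (x∉p ∘ there))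
x∉p⇒∣p∪⁅x⁆∣≡suc∣p∣ {x = suc x} {false ∷ p} x∉p = x∉p⇒∣p∪⁅x⁆∣≡suc∣p∣ (x∉p ∘ there)

∣p∣<n⇒∃∉ : (p : Subset n) → ∣ p ∣ < n → ∃ λ x → x ∉ p
∣p∣<n⇒∃∉ (false ∷ p) _         = zero , λ ()
∣p∣<n⇒∃∉ (true ∷ p)  (s≤s ∣p∣<n) with ∣p∣<n⇒∃∉ p ∣p∣<n
... | x , x∉p = suc x , x∉p ∘ drop-there

∃⊇-of-size : ∀ d (p : Subset n) → ∣ p ∣ + d ≤ n → ∃ λ t → p ⊆ t × ∣ t ∣ ≡ ∣ p ∣ + d
∃⊇-of-size zero    p _ = p , id , sym (+-identityʳ ∣ p ∣)
∃⊇-of-size (suc d) p ≤n with ∣p∣<n⇒∃∉ p (<-≤-trans (m<m+n ∣ p ∣ (s≤s z≤n)) ≤n)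
... | x , x∉p =
  let t , p∪x⊆t , ∣t∣≡ = ∃⊇-of-size d (p ∪ ⁅ x ⁆) (≤-trans (≤-reflexive size-shift) ≤n)
  in  t , p∪x⊆t ∘ x∈p∪q⁺ ∘ inj₁ , trans ∣t∣≡ size-shift
  where
  size-shift : ∣ p ∪ ⁅ x ⁆ ∣ + d ≡ ∣ p ∣ + suc d
  size-shift = trans (cong (_+ d) (x∉p⇒∣p∪⁅x⁆∣≡suc∣p∣ x∉p)) (sym (+-suc ∣ p ∣ d))

x∈p∧y∈p∧x≢y⇒2≤∣p∣ : {x y : Fin n} {p : Subset n} → x ∈ p → y ∈ p → x ≢ y → 2 ≤ ∣ p ∣
x∈p∧y∈p∧x≢y⇒2≤∣p∣ x∈p y∈p x≢y =
  ≤-trans (s≤s (≤-trans (s≤s z≤n) (x∈p⇒∣p-x∣<∣p∣ (x∈p∧x≢y⇒x∈p-y y∈p (x≢y ∘ sym))))) (x∈p⇒∣p-x∣<∣p∣ x∈p)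

∣p∣≡2⇒∃distinct : (p : Subset n) → ∣ p ∣ ≡ 2 → ∃ λ x → ∃ λ y → x ∈ p × y ∈ p × x ≢ y
∣p∣≡2⇒∃distinct p ∣p∣≡2 with 0<∣p∣⇒Nonempty p (subst (0 <_) (sym ∣p∣≡2) (s≤s z≤n))
... | x , x∈p with 0<∣p∣⇒Nonempty (p - x)
                    (subst (0 <_) (sym (suc-injective (trans (x∈p⇒suc∣p-x∣≡∣p∣ x∈p) ∣p∣≡2))) (s≤s z≤n))
...   | y , y∈p-x = x , y , x∈p , p─q⊆p p _ y∈p-x , x∈p-y⇒x≢y y∈p-x ∘ sym

∣⁅x⁆∪⁅y⁆∣≡2 : {x y : Fin n} → x ≢ y → ∣ ⁅ x ⁆ ∪ ⁅ y ⁆ ∣ ≡ 2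
∣⁅x⁆∪⁅y⁆∣≡2 {x = x} x≢y = trans (x∉p⇒∣p∪⁅x⁆∣≡suc∣p∣ (x≢y ∘ sym ∘ x∈⁅y⁆⇒x≡y x)) (cong suc (∣⁅x⁆∣≡1 x))

adj≡true⇒≢ : (G : Graph n) {x y : Fin n} → adj G x y ≡ true → x ≢ y
adj≡true⇒≢ G {x} xy refl = contradiction (trans (sym xy) (adj-irr G x)) λ ()

Dominates : Graph n → Subset n → Fin n → Set
Dominates G D v = v ∈ D ⊎ ∃ λ u → u ∈ D × adj G u v ≡ true

dominates? : (G : Graph n) (D : Subset n) → Decidable (Dominates G D)
dominates? G D v = (v ∈? D) ⊎-dec any? (λ u → (u ∈? D) ×-dec (adj G u v ≟ᵇ true))

dominating? : (G : Graph n) (D : Subset n) → Dec (Dominating G D)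
dominating? G D = all? (dominates? G D)

Dominating-mono : (G : Graph n) {D E : Subset n} → D ⊆ E → Dominating G D → Dominating G E
Dominating-mono G D⊆E dom v with dom v
... | inj₁ v∈D            = inj₁ (D⊆E v∈D)
... | inj₂ (u , u∈D , uv) = inj₂ (u , D⊆E u∈D , uv)

Dominating⇒Nonempty : (G : Graph n) {D : Subset n} → Fin n → Dominating G D → Nonempty D
Dominating⇒Nonempty G v dom with dom v
... | inj₁ v∈D           = v , v∈D
... | inj₂ (u , u∈D , _) = u , u∈D

minimal-dominating-⊆′ : (G : Graph n) → ∀ k D → ∣ D ∣ < k → Dominating G D →
                        ∃ λ T → T ⊆ D × MinDominating G T
minimal-dominating-⊆′ G (suc k) D ∣D∣≤k dom with any? (λ x → (x ∈? D) ×-dec dominating? G (D - x))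
... | yes (x , x∈D , dom-x)
  with minimal-dominating-⊆′ G k (D - x) (<-≤-trans (x∈p⇒∣p-x∣<∣p∣ x∈D) (≤-pred ∣D∣≤k)) dom-x
...   | T , T⊆D-x , minT = T , p─q⊆p D _ ∘ T⊆D-x , minT
minimal-dominating-⊆′ G (suc k) D _ dom | no irremovable = D , id , dom , minimal
  where
  minimal : ∀ T → T ⊆ D → Dominating G T → T ≡ D
  minimal T T⊆D domT = ⊆-antisym T⊆D D⊆T
    where
    D⊆T : D ⊆ T
    D⊆T {x} x∈D with x ∈? T
    ... | yes x∈T = x∈T
    ... | no  x∉T = contradiction (x , x∈D , Dominating-mono G T⊆D-x domT) irremovable
      where
      T⊆D-x : T ⊆ D - x
      T⊆D-x y∈T = x∈p∧x≢y⇒x∈p-y (T⊆D y∈T) λ { refl → x∉T y∈T }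

minimal-dominating-⊆ : (G : Graph n) {D : Subset n} → Dominating G D → ∃ λ T → T ⊆ D × MinDominating G T
minimal-dominating-⊆ G {D} = minimal-dominating-⊆′ G (suc ∣ D ∣) D (s≤s ≤-refl)

EveryOfSizeDominates : Graph n → ℕ → Set
EveryOfSizeDominates G r = ∀ S → ∣ S ∣ ≡ r → Dominating G S

DominationNumber≥ : Graph n → ℕ → Set
DominationNumber≥ G r = ∀ S → Dominating G S → r ≤ ∣ S ∣

𝒰≡𝒟⇔ : (G : Graph n) (r : ℕ) → (𝒰 r ≡Fam 𝒟 G) ⇔ (EveryOfSizeDominates G r × DominationNumber≥ G r)
𝒰≡𝒟⇔ G r = mk⇔ to from
  where
  to : 𝒰 r ≡Fam 𝒟 G → EveryOfSizeDominates G r × DominationNumber≥ G r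
  to 𝒰≡𝒟 = (λ S ∣S∣≡r → proj₁ (Equivalence.to (𝒰≡𝒟 S) ∣S∣≡r)) , γ≥
    where
    γ≥ : DominationNumber≥ G r
    γ≥ S domS with minimal-dominating-⊆ G domS
    ... | T , T⊆S , minT = subst (_≤ ∣ S ∣) (Equivalence.from (𝒰≡𝒟 T) minT) (p⊆q⇒∣p∣≤∣q∣ T⊆S)
  from : EveryOfSizeDominates G r × DominationNumber≥ G r → 𝒰 r ≡Fam 𝒟 G
  from (sized , γ≥) S = mk⇔ minimal size
    where
    minimal : ∣ S ∣ ≡ r → MinDominating G S
    minimal ∣S∣≡r = sized S ∣S∣≡r , λ T T⊆S domT →
      ⊆∧∣q∣≤∣p∣⇒p≡q T⊆S (subst (_≤ ∣ T ∣) (sym ∣S∣≡r) (γ≥ T domT))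
    size : MinDominating G S → ∣ S ∣ ≡ r
    size (domS , minS) with ∃⊆-of-size r S (γ≥ S domS)
    ... | T , T⊆S , ∣T∣≡r = trans (cong ∣_∣ (sym (minS T T⊆S (sized T ∣T∣≡r)))) ∣T∣≡r

NonAdjacent : Graph n → Fin n → Fin n → Set
NonAdjacent G w x = x ≢ w × adj G w x ≡ false

nonNeighbours : Graph n → Fin n → Subset n
nonNeighbours G w = subsetOf λ x → ¬? (x ≟ w) ×-dec (adj G w x ≟ᵇ false)

∈nonNeighbours⇔ : (G : Graph n) {w x : Fin n} → x ∈ nonNeighbours G w ⇔ NonAdjacent G w x
∈nonNeighbours⇔ G {w} = ∈-subsetOf λ x → ¬? (x ≟ w) ×-dec (adj G w x ≟ᵇ false)

∈nonNeighbours-sym : (G : Graph n) {w x : Fin n} → x ∈ nonNeighbours G w → w ∈ nonNeighbours G x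
∈nonNeighbours-sym G {w} {x} x∈ with Equivalence.to (∈nonNeighbours⇔ G) x∈
... | x≢w , wx = Equivalence.from (∈nonNeighbours⇔ G) (x≢w ∘ sym , trans (adj-sym G x w) wx)

⊆nonNeighbours⇒¬Dominates : (G : Graph n) {w : Fin n} {D : Subset n} →
                            D ⊆ nonNeighbours G w → ¬ Dominates G D w
⊆nonNeighbours⇒¬Dominates G D⊆ (inj₁ w∈D) = proj₁ (Equivalence.to (∈nonNeighbours⇔ G) (D⊆ w∈D)) refl
⊆nonNeighbours⇒¬Dominates G {w} D⊆ (inj₂ (u , u∈D , uw)) with Equivalence.to (∈nonNeighbours⇔ G) (D⊆ u∈D)
... | _ , wu = contradiction (trans (sym uw) (trans (adj-sym G u w) wu)) λ ()

¬Dominating⇒⊆nonNeighbours : (G : Graph n) {D : Subset n} → ¬ Dominating G D →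
                             ∃ λ w → w ∉ D × D ⊆ nonNeighbours G w
¬Dominating⇒⊆nonNeighbours {n} G {D} ¬dom with ¬∀⟶∃¬ n _ (dominates? G D) ¬dom
... | w , ¬domw = w , ¬domw ∘ inj₁ , λ {u} u∈D → Equivalence.from (∈nonNeighbours⇔ G)
        ((λ { refl → ¬domw (inj₁ u∈D) }) , ¬-not λ wu → ¬domw (inj₂ (u , u∈D , trans (adj-sym G u w) wu)))

EveryOfSizeDominates⇒∣nonNeighbours∣< : (G : Graph n) {r : ℕ} → EveryOfSizeDominates G r →
                                        ∀ w → ∣ nonNeighbours G w ∣ < r
EveryOfSizeDominates⇒∣nonNeighbours∣< G {r} sized w with ∣ nonNeighbours G w ∣ <? r
... | yes ∣N∣<r = ∣N∣<r
... | no  ∣N∣≮r with ∃⊆-of-size r (nonNeighbours G w) (≮⇒≥ ∣N∣≮r)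
...   | U , U⊆N , ∣U∣≡r = contradiction (sized U ∣U∣≡r w) (⊆nonNeighbours⇒¬Dominates G U⊆N)

-- Under 𝒰 (suc k) = 𝒟 G every k-set fails to dominate some vertex, whose non-neighbourhood
-- contains the k-set and has at most k elements.
∣T∣≡k⇒T≡nonNeighbours : (G : Graph n) {k : ℕ} → EveryOfSizeDominates G (suc k) → DominationNumber≥ G (suc k) →
                        ∀ T → ∣ T ∣ ≡ k → ∃ λ w → w ∉ T × T ≡ nonNeighbours G w
∣T∣≡k⇒T≡nonNeighbours G sized γ≥ T ∣T∣≡k
  with ¬Dominating⇒⊆nonNeighbours G (λ domT → <-irrefl (sym ∣T∣≡k) (γ≥ T domT))
... | w , w∉T , T⊆N = w , w∉T ,
  ⊆∧∣q∣≤∣p∣⇒p≡q T⊆N (subst (∣ nonNeighbours G w ∣ ≤_) (sym ∣T∣≡k)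
                              (≤-pred (EveryOfSizeDominates⇒∣nonNeighbours∣< G sized w)))

-- The cases r = 1, r = n and r = 2

𝒰₁≡𝒟⇔IsComplete : Fin n → (G : Graph n) → (𝒰 1 ≡Fam 𝒟 G) ⇔ IsComplete G
𝒰₁≡𝒟⇔IsComplete v G = mk⇔ (complete ∘ Equivalence.to (𝒰≡𝒟⇔ G 1)) (Equivalence.from (𝒰≡𝒟⇔ G 1) ∘ conditions)
  where
  complete : EveryOfSizeDominates G 1 × DominationNumber≥ G 1 → IsComplete G
  complete (sized , _) x y = mk⇔ (adj≡true⇒≢ G) adjacent
    where
    adjacent : x ≢ y → adj G x y ≡ true
    adjacent x≢y with sized ⁅ x ⁆ (∣⁅x⁆∣≡1 x) y
    ... | inj₁ y∈⁅x⁆               = contradiction (sym (x∈⁅y⁆⇒x≡y x y∈⁅x⁆)) x≢y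
    ... | inj₂ (u , u∈⁅x⁆ , uy) = subst (λ u → adj G u y ≡ true) (x∈⁅y⁆⇒x≡y x u∈⁅x⁆) uy
  conditions : IsComplete G → EveryOfSizeDominates G 1 × DominationNumber≥ G 1
  conditions complete = sized , λ S domS → x∈p⇒0<∣p∣ (proj₂ (Dominating⇒Nonempty G v domS))
    where
    sized : EveryOfSizeDominates G 1
    sized S ∣S∣≡1 y with 0<∣p∣⇒Nonempty S (≤-reflexive (sym ∣S∣≡1))
    ... | x , x∈S with y ≟ x
    ...   | yes refl = inj₁ x∈S
    ...   | no  y≢x  = inj₂ (x , x∈S , Equivalence.from (complete x y) (y≢x ∘ sym))

𝒰ₙ≡𝒟⇔IsEdgeless : (G : Graph n) → (𝒰 n ≡Fam 𝒟 G) ⇔ IsEdgeless G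
𝒰ₙ≡𝒟⇔IsEdgeless {n} G = mk⇔ (edgeless ∘ Equivalence.to (𝒰≡𝒟⇔ G n)) (Equivalence.from (𝒰≡𝒟⇔ G n) ∘ conditions)
  where
  edgeless : EveryOfSizeDominates G n × DominationNumber≥ G n → IsEdgeless G
  edgeless (_ , γ≥) x y = ¬-not λ xy → <-irrefl refl
    (<-≤-trans (x∈p⇒∣p-x∣<∣p∣ {p = ⊤ {n}} ∈⊤) (≤-trans (≤-reflexive (∣⊤∣≡n n)) (γ≥ (⊤ - x) (dominating xy))))
    where
    dominating : adj G x y ≡ true → Dominating G (⊤ - x)
    dominating xy v with v ≟ x
    ... | yes refl = inj₂ (y , x∈p∧x≢y⇒x∈p-y ∈⊤ (adj≡true⇒≢ G xy ∘ sym) , trans (adj-sym G y x) xy)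
    ... | no  v≢x  = inj₁ (x∈p∧x≢y⇒x∈p-y ∈⊤ v≢x)
  conditions : IsEdgeless G → EveryOfSizeDominates G n × DominationNumber≥ G n
  conditions edgeless = sized , γ≥
    where
    sized : EveryOfSizeDominates G n
    sized S ∣S∣≡n v = inj₁ (subst (v ∈_) (sym (∣p∣≡n⇒p≡⊤ ∣S∣≡n)) ∈⊤)
    γ≥ : DominationNumber≥ G n
    γ≥ S domS = subst (_≤ ∣ S ∣) (∣⊤∣≡n n) (p⊆q⇒∣p∣≤∣q∣ ⊤⊆S)
      where
      ⊤⊆S : ⊤ ⊆ S
      ⊤⊆S {v} _ with domS v
      ... | inj₁ v∈S           = v∈S
      ... | inj₂ (u , _ , uv) = contradiction (trans (sym uv) (edgeless u v)) λ ()

𝒰₂≡𝒟⇔IsJoinOfPairs : Fin n → (G : Graph n) → (𝒰 2 ≡Fam 𝒟 G) ⇔ IsJoinOfPairs G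
𝒰₂≡𝒟⇔IsJoinOfPairs v G = mk⇔ (join ∘ Equivalence.to (𝒰≡𝒟⇔ G 2)) (Equivalence.from (𝒰≡𝒟⇔ G 2) ∘ conditions)
  where
  join : EveryOfSizeDominates G 2 × DominationNumber≥ G 2 → IsJoinOfPairs G
  join (sized , γ≥) = σ , σ-involutive , σ-≢ , adjacency
    where
    singleton : ∀ x → ∃ λ w → w ∉ ⁅ x ⁆ × ⁅ x ⁆ ≡ nonNeighbours G w
    singleton x = ∣T∣≡k⇒T≡nonNeighbours G sized γ≥ ⁅ x ⁆ (∣⁅x⁆∣≡1 x)
    σ : Fin _ → Fin _
    σ x = proj₁ (singleton x)
    ⁅x⁆≡N[σx] : ∀ x → ⁅ x ⁆ ≡ nonNeighbours G (σ x)
    ⁅x⁆≡N[σx] x = proj₂ (proj₂ (singleton x))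
    σ-≢ : ∀ x → σ x ≢ x
    σ-≢ x = x∉⁅y⁆⇒x≢y (proj₁ (proj₂ (singleton x)))
    σ-involutive : ∀ x → σ (σ x) ≡ x
    σ-involutive x = x∈⁅y⁆⇒x≡y x (subst (σ (σ x) ∈_) (sym (⁅x⁆≡N[σx] x))
      (∈nonNeighbours-sym G (subst (σ x ∈_) (⁅x⁆≡N[σx] (σ x)) (x∈⁅x⁆ (σ x)))))
    N[x]≡⁅σx⁆ : ∀ x → nonNeighbours G x ≡ ⁅ σ x ⁆
    N[x]≡⁅σx⁆ x = sym (subst (λ y → ⁅ σ x ⁆ ≡ nonNeighbours G y) (σ-involutive x) (⁅x⁆≡N[σx] (σ x)))
    adjacency : ∀ x y → adj G x y ≡ true ⇔ (x ≢ y × y ≢ σ x)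
    adjacency x y = mk⇔
      (λ xy → adj≡true⇒≢ G xy , λ { refl → contradiction (trans (sym xy) x≁σx) λ () })
      (λ (x≢y , y≢σx) → ¬-not λ x≁y → y≢σx (x∈⁅y⁆⇒x≡y (σ x) (subst (y ∈_) (N[x]≡⁅σx⁆ x)
        (Equivalence.from (∈nonNeighbours⇔ G) (x≢y ∘ sym , x≁y)))))
      where
      x≁σx : adj G x (σ x) ≡ false
      x≁σx = proj₂ (Equivalence.to (∈nonNeighbours⇔ G) (subst (σ x ∈_) (sym (N[x]≡⁅σx⁆ x)) (x∈⁅x⁆ (σ x))))
  conditions : IsJoinOfPairs G → EveryOfSizeDominates G 2 × DominationNumber≥ G 2
  conditions (σ , σ-involutive , σ-≢ , adjacency) = sized , γ≥
    where
    adjacent : ∀ {x y} → x ≢ y → y ≢ σ x → adj G x y ≡ true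
    adjacent x≢y y≢σx = Equivalence.from (adjacency _ _) (x≢y , y≢σx)
    sized : EveryOfSizeDominates G 2
    sized S ∣S∣≡2 y with ∣p∣≡2⇒∃distinct S ∣S∣≡2
    ... | x , x′ , x∈S , x′∈S , x≢x′ with y ∈? S | y ≟ σ x
    ...   | yes y∈S | _        = inj₁ y∈S
    ...   | no  y∉S | no  y≢σx = inj₂ (x , x∈S , adjacent (λ { refl → y∉S x∈S }) y≢σx)
    ...   | no  y∉S | yes refl = inj₂ (x′ , x′∈S , adjacent (λ { refl → y∉S x′∈S }) (x≢x′ ∘ σ-injective))
      where
      σ-injective : σ x ≡ σ x′ → x ≡ x′
      σ-injective σx≡σx′ = trans (sym (σ-involutive x)) (trans (cong σ σx≡σx′) (σ-involutive x′))
    γ≥ : DominationNumber≥ G 2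
    γ≥ S domS with Dominating⇒Nonempty G v domS
    ... | x , x∈S with domS (σ x)
    ...   | inj₁ σx∈S             = x∈p∧y∈p∧x≢y⇒2≤∣p∣ x∈S σx∈S (σ-≢ x ∘ sym)
    ...   | inj₂ (u , u∈S , uσx) =
      x∈p∧y∈p∧x≢y⇒2≤∣p∣ x∈S u∈S λ { refl → proj₂ (Equivalence.to (adjacency x (σ x)) uσx) refl }

-- No 𝒰 r with 3 ≤ r < n is a domination hypergraph

-- C = S ∪ ⁅ v ⁆ is closed under taking non-neighbours: for w ∈ S, the k-set C - w is the
-- non-neighbourhood of a vertex, which must lie in S (it is a non-neighbour of v) and then be w.
nonNeighbours⊆ : (G : Graph n) {k : ℕ} → EveryOfSizeDominates G (suc k) → DominationNumber≥ G (suc k) →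
                 {S : Subset n} {v : Fin n} → ∣ S ∣ ≡ k → v ∉ S → S ≡ nonNeighbours G v →
                 ∀ {w} → w ∈ S → nonNeighbours G w ⊆ S ∪ ⁅ v ⁆
nonNeighbours⊆ G {k} sized γ≥ {S} {v} ∣S∣≡k v∉S S≡N[v] {w} w∈S {x} x∈N[w] =
  p─q⊆p C _ (subst (x ∈_) (sym C-w≡N[w]) x∈N[w])
  where
  C : Subset _
  C = S ∪ ⁅ v ⁆
  ∣C-w∣≡k : ∣ C - w ∣ ≡ k
  ∣C-w∣≡k = suc-injective (begin
    suc ∣ C - w ∣ ≡⟨ x∈p⇒suc∣p-x∣≡∣p∣ (x∈p∪q⁺ (inj₁ w∈S)) ⟩
    ∣ C ∣         ≡⟨ x∉p⇒∣p∪⁅x⁆∣≡suc∣p∣ v∉S ⟩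
    suc ∣ S ∣     ≡⟨ cong suc ∣S∣≡k ⟩
    suc k         ∎)
  C-w≡N[w] : C - w ≡ nonNeighbours G w
  C-w≡N[w] with ∣T∣≡k⇒T≡nonNeighbours G sized γ≥ (C - w) ∣C-w∣≡k
  ... | w′ , w′∉C-w , C-w≡N[w′] with w′ ≟ w
  ...   | yes refl = C-w≡N[w′]
  ...   | no  w′≢w = contradiction (x∈p∧x≢y⇒x∈p-y (x∈p∪q⁺ (inj₁ w′∈S)) w′≢w) w′∉C-w
    where
    v∈C-w : v ∈ C - w
    v∈C-w = x∈p∧x≢y⇒x∈p-y (x∈p∪q⁺ (inj₂ (x∈⁅x⁆ v))) λ { refl → v∉S w∈S }
    w′∈S : w′ ∈ S
    w′∈S = subst (w′ ∈_) (sym S≡N[v]) (∈nonNeighbours-sym G (subst (v ∈_) C-w≡N[w′] v∈C-w))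

-- A k-set containing t and v is the non-neighbourhood of some w, and w ∈ S as v is a
-- non-neighbour of w; so t lies in S ∪ ⁅ v ⁆ by its closure under non-neighbours.
closure-covers : (G : Graph n) {j : ℕ} → EveryOfSizeDominates G (3 + j) → DominationNumber≥ G (3 + j) →
                 {S : Subset n} {v : Fin n} → ∣ S ∣ ≡ 2 + j → v ∉ S → S ≡ nonNeighbours G v →
                 2 + j ≤ n → ∀ t → t ∈ S ∪ ⁅ v ⁆
closure-covers {n} G {j} sized γ≥ {S} {v} ∣S∣≡k v∉S S≡N[v] k≤n t with t ≟ v
... | yes refl = x∈p∪q⁺ (inj₂ (x∈⁅x⁆ t))
... | no  t≢v with ∃⊇-of-size j (⁅ t ⁆ ∪ ⁅ v ⁆) (subst (λ m → m + j ≤ n) (sym (∣⁅x⁆∪⁅y⁆∣≡2 t≢v)) k≤n)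
...   | T , t,v⊆T , ∣T∣≡ with ∣T∣≡k⇒T≡nonNeighbours G sized γ≥ T (trans ∣T∣≡ (cong (_+ j) (∣⁅x⁆∪⁅y⁆∣≡2 t≢v)))
...     | w , _ , T≡N[w] =
  nonNeighbours⊆ G sized γ≥ ∣S∣≡k v∉S S≡N[v] w∈S (T⊆N[w] (t,v⊆T (x∈p∪q⁺ (inj₁ (x∈⁅x⁆ t)))))
  where
  T⊆N[w] : T ⊆ nonNeighbours G w
  T⊆N[w] = subst (T ⊆_) T≡N[w] id
  w∈S : w ∈ S
  w∈S = subst (w ∈_) (sym S≡N[v]) (∈nonNeighbours-sym G (T⊆N[w] (t,v⊆T (x∈p∪q⁺ (inj₂ (x∈⁅x⁆ v))))))

¬𝒰₃₊ⱼ≡𝒟 : (G : Graph n) (j : ℕ) → 3 + j < n → ¬ (𝒰 (3 + j) ≡Fam 𝒟 G)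
¬𝒰₃₊ⱼ≡𝒟 {n} G j 3+j<n 𝒰≡𝒟 = impossible (Equivalence.to (𝒰≡𝒟⇔ G (3 + j)) 𝒰≡𝒟)
  where
  2+j≤n : 2 + j ≤ n
  2+j≤n = ≤-trans (n≤1+n _) (<⇒≤ 3+j<n)
  impossible : ¬ (EveryOfSizeDominates G (3 + j) × DominationNumber≥ G (3 + j))
  impossible (sized , γ≥) with ∃⊆-of-size (2 + j) ⊤ (subst (2 + j ≤_) (sym (∣⊤∣≡n n)) 2+j≤n)
  ... | S , _ , ∣S∣≡k with ∣T∣≡k⇒T≡nonNeighbours G sized γ≥ S ∣S∣≡k
  ... | v , v∉S , S≡N[v] with ∣p∣<n⇒∃∉ (S ∪ ⁅ v ⁆) (subst (_< n) (sym ∣C∣≡3+j) 3+j<n)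
    where
    ∣C∣≡3+j : ∣ S ∪ ⁅ v ⁆ ∣ ≡ 3 + j
    ∣C∣≡3+j = trans (x∉p⇒∣p∪⁅x⁆∣≡suc∣p∣ v∉S) (cong suc ∣S∣≡k)
  ... | t , t∉C = t∉C (closure-covers G sized γ≥ ∣S∣≡k v∉S S≡N[v] 2+j≤n t)

-- Perfect matchings, i.e. fixed-point-free involutions

record PerfectMatching (n : ℕ) : Set where
  field
    partner            : Fin n → Fin n
    partner-involutive : ∀ x → partner (partner x) ≡ x
    partner-≢          : ∀ x → partner x ≢ x
open PerfectMatching

emptyMatching : PerfectMatching 0
emptyMatching = record { partner = λ () ; partner-involutive = λ () ; partner-≢ = λ () }

-- skip j embeds Fin k into Fin (2 + k), missing exactly zero and suc j. A perfect matching on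
-- Fin (2 + k) is the pair {zero, suc j} together with a perfect matching carried over by skip j,
-- which gives both the recursive enumeration and the evenness of n.
module Skip {k : ℕ} (j : Fin (suc k)) where

  skip : Fin k → Fin (suc (suc k))
  skip a = suc (punchIn j a)

  skip-injective : ∀ {a b} → skip a ≡ skip b → a ≡ b
  skip-injective = punchIn-injective j _ _ ∘ Fin.suc-injective

  skip≢mate : ∀ a → skip a ≢ suc j
  skip≢mate a = punchInᵢ≢i j a ∘ Fin.suc-injective

  data View : Fin (suc (suc k)) → Set where
    first   : View zero
    mate    : View (suc j)
    skipped : ∀ a → View (skip a)

  view : ∀ x → View x
  view zero    = first
  view (suc i) with j ≟ i
  ... | yes refl = mate
  ... | no  j≢i  = subst (View ∘ suc) (punchIn-punchOut j≢i) (skipped (punchOut j≢i))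

  skip-onto : ∀ x → x ≢ zero → x ≢ suc j → ∃ λ a → skip a ≡ x
  skip-onto x x≢0 x≢mate with view x
  ... | first     = contradiction refl x≢0
  ... | mate      = contradiction refl x≢mate
  ... | skipped a = a , refl

  extendPartner : (Fin k → Fin k) → Fin (suc (suc k)) → Fin (suc (suc k))
  extendPartner τ zero    = suc j
  extendPartner τ (suc i) with j ≟ i
  ... | yes _   = zero
  ... | no  j≢i = skip (τ (punchOut j≢i))

  extendPartner-mate : ∀ τ → extendPartner τ (suc j) ≡ zero
  extendPartner-mate τ with j ≟ j
  ... | yes _   = refl
  ... | no  j≢j = contradiction refl j≢j

  extendPartner-skip : ∀ τ a → extendPartner τ (skip a) ≡ skip (τ a)
  extendPartner-skip τ a with j ≟ punchIn j a
  ... | yes j≡ = contradiction (sym j≡) (punchInᵢ≢i j a)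
  ... | no  j≢ = cong (skip ∘ τ) (trans (punchOut-cong j refl) (punchOut-punchIn j))

  extend : PerfectMatching k → PerfectMatching (suc (suc k))
  extend M = record
    { partner            = extendPartner (partner M)
    ; partner-involutive = involutive
    ; partner-≢          = irreflexive
    }
    where
    involutive : ∀ x → extendPartner (partner M) (extendPartner (partner M) x) ≡ x
    involutive x with view x
    ... | first     = extendPartner-mate (partner M)
    ... | mate      = cong (extendPartner (partner M)) (extendPartner-mate (partner M))
    ... | skipped a = begin
      extendPartner (partner M) (extendPartner (partner M) (skip a))
        ≡⟨ cong (extendPartner (partner M)) (extendPartner-skip (partner M) a) ⟩
      extendPartner (partner M) (skip (partner M a))
        ≡⟨ extendPartner-skip (partner M) (partner M a) ⟩
      skip (partner M (partner M a))
        ≡⟨ cong skip (partner-involutive M a) ⟩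
      skip a ∎
    irreflexive : ∀ x → extendPartner (partner M) x ≢ x
    irreflexive x with view x
    ... | first     = λ ()
    ... | mate      = λ σx≡x → contradiction (trans (sym (extendPartner-mate (partner M))) σx≡x) λ ()
    ... | skipped a = λ σx≡x → partner-≢ M a (skip-injective (trans (sym (extendPartner-skip (partner M) a)) σx≡x))

  extend-cong : ∀ {M M′} → partner M ≗ partner M′ → partner (extend M) ≗ partner (extend M′)
  extend-cong {M} {M′} M≗M′ x with view x
  ... | first     = refl
  ... | mate      = trans (extendPartner-mate (partner M)) (sym (extendPartner-mate (partner M′)))
  ... | skipped a = trans (extendPartner-skip (partner M) a)
                          (trans (cong skip (M≗M′ a)) (sym (extendPartner-skip (partner M′) a)))

  extend-injective : ∀ {M M′} → partner (extend M) ≗ partner (extend M′) → partner M ≗ partner M′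
  extend-injective {M} {M′} eM≗eM′ a = skip-injective (begin
    skip (partner M a)                ≡⟨ extendPartner-skip (partner M) a ⟨
    extendPartner (partner M) (skip a)  ≡⟨ eM≗eM′ (skip a) ⟩
    extendPartner (partner M′) (skip a) ≡⟨ extendPartner-skip (partner M′) a ⟩
    skip (partner M′ a)               ∎)

open Skip using (extend; extend-cong; extend-injective)

adjacentPairs : ∀ q → PerfectMatching (q * 2)
adjacentPairs zero    = emptyMatching
adjacentPairs (suc q) = extend zero (adjacentPairs q)

module _ {k : ℕ} (M : PerfectMatching (suc (suc k))) where

  private
    σ : Fin (suc (suc k)) → Fin (suc (suc k))
    σ = partner M

  firstMate : Fin (suc k)
  firstMate = punchOut (partner-≢ M zero ∘ sym)

  suc-firstMate : suc firstMate ≡ σ zero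
  suc-firstMate = punchIn-punchOut (partner-≢ M zero ∘ sym)

  open Skip firstMate hiding (extend; extend-cong; extend-injective)

  private
    σ-skip : ∀ a → ∃ λ b → skip b ≡ σ (skip a)
    σ-skip a = skip-onto (σ (skip a)) σx≢0 σx≢mate
      where
      σx≢0 : σ (skip a) ≢ zero
      σx≢0 σx≡0 = skip≢mate a
        (trans (sym (partner-involutive M (skip a))) (trans (cong σ σx≡0) (sym suc-firstMate)))
      σx≢mate : σ (skip a) ≢ suc firstMate
      σx≢mate σx≡mate = contradiction (trans (sym (partner-involutive M (skip a)))
                          (trans (cong σ (trans σx≡mate suc-firstMate)) (partner-involutive M zero))) λ ()

    τ : Fin k → Fin k
    τ a = proj₁ (σ-skip a)

    skip-τ : ∀ a → skip (τ a) ≡ σ (skip a)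
    skip-τ a = proj₂ (σ-skip a)

  restrict : PerfectMatching k
  restrict = record
    { partner            = τ
    ; partner-involutive = λ a → skip-injective (begin
        skip (τ (τ a))   ≡⟨ skip-τ (τ a) ⟩
        σ (skip (τ a))   ≡⟨ cong σ (skip-τ a) ⟩
        σ (σ (skip a))   ≡⟨ partner-involutive M (skip a) ⟩
        skip a           ∎)
    ; partner-≢          = λ a τa≡a → partner-≢ M (skip a) (trans (sym (skip-τ a)) (cong skip τa≡a))
    }

  extend-restrict : partner (extend firstMate restrict) ≗ σ
  extend-restrict x with view x
  ... | first     = suc-firstMate
  ... | mate      = trans (extendPartner-mate τ) (sym (trans (cong σ suc-firstMate) (partner-involutive M zero)))
  ... | skipped a = trans (extendPartner-skip τ a) (skip-τ a)

PerfectMatching⇒even : PerfectMatching n → 2 ∣ n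
PerfectMatching⇒even {zero}          _ = divides 0 refl
PerfectMatching⇒even {suc zero}      M = contradiction (Fin1-unique (partner M zero)) (partner-≢ M zero)
  where
  Fin1-unique : (x : Fin 1) → x ≡ zero
  Fin1-unique zero = refl
PerfectMatching⇒even {suc (suc n)}   M = ∣m∣n⇒∣m+n ∣-refl (PerfectMatching⇒even (restrict M))

perfectMatchings : ∀ q → List (PerfectMatching (q * 2))
extensions : ∀ q → Fin (suc (q * 2)) → List (PerfectMatching (suc q * 2))

perfectMatchings zero    = emptyMatching ∷ []
perfectMatchings (suc q) = concat (tabulate (extensions q))

extensions q j = map (extend j) (perfectMatchings q)

perfectMatchingCount : ℕ → ℕ
perfectMatchingCount zero    = 1
perfectMatchingCount (suc q) = suc (q * 2) * perfectMatchingCount q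

length-concat-tabulate : ∀ {A : Set} {k c : ℕ} (f : Fin k → List A) → (∀ j → length (f j) ≡ c) →
                         length (concat (tabulate f)) ≡ k * c
length-concat-tabulate {k = zero}      f _ = refl
length-concat-tabulate {k = suc k} {c} f ∣f∣≡c = begin
  length (f zero ++ concat (tabulate (f ∘ suc)))
    ≡⟨ length-++ (f zero) ⟩
  length (f zero) + length (concat (tabulate (f ∘ suc)))
    ≡⟨ cong₂ _+_ (∣f∣≡c zero) (length-concat-tabulate (f ∘ suc) (∣f∣≡c ∘ suc)) ⟩
  c + k * c ∎

length-perfectMatchings : ∀ q → length (perfectMatchings q) ≡ perfectMatchingCount q
length-perfectMatchings zero    = refl
length-perfectMatchings (suc q) = length-concat-tabulate (extensions q) λ j →
  trans (length-map (extend j) (perfectMatchings q)) (length-perfectMatchings q)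

_≉ₘ_ : PerfectMatching n → PerfectMatching n → Set
M ≉ₘ M′ = ¬ (partner M ≗ partner M′)

perfectMatchings-distinct : ∀ q → AllPairs _≉ₘ_ (perfectMatchings q)
perfectMatchings-distinct zero    = All.[] ∷ []
perfectMatchings-distinct (suc q) = AllPairs.concat⁺ (All.tabulate⁺ {f = extensions q} within) across
  where
  within : ∀ j → AllPairs _≉ₘ_ (extensions q j)
  within j = AllPairs.map⁺ {f = extend j}
    (AllPairs.map (λ {M} {M′} M≉M′ → M≉M′ ∘ extend-injective j {M} {M′}) (perfectMatchings-distinct q))
  -- Matchings from different blocks already differ at zero, which extend i sends to suc i.
  across : AllPairs (λ Ms Ms′ → All (λ M → All (M ≉ₘ_) Ms′) Ms) (tabulate (extensions q))
  across = AllPairs.tabulate⁺ {f = extensions q} λ i≢j → All.map⁺ (All.universal (λ _ → All.map⁺ (All.universal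
    (λ _ eM≗eM′ → i≢j (Fin.suc-injective (eM≗eM′ zero))) _)) _)

perfectMatchings-complete : ∀ q (M : PerfectMatching (q * 2)) →
                            Any (λ M′ → partner M ≗ partner M′) (perfectMatchings q)
perfectMatchings-complete zero    M = here λ ()
perfectMatchings-complete (suc q) M =
  Any.concat⁺ (Any.tabulate⁺ {f = extensions q} j (Any.map⁺ {f = extend j}
    (Any.map (λ {M′} M≗M′ x → trans (sym (extend-restrict M x)) (extend-cong j {restrict M} {M′} M≗M′ x))
             (perfectMatchings-complete q (restrict M)))))
  where
  j : Fin (suc (q * 2))
  j = firstMate M

graphOf : {R : Fin n → Fin n → Set} → (∀ x y → Dec (R x y)) → (∀ {x y} → R x y → R y x) → (∀ x → ¬ R x x) →
          Graph n
graphOf R? R-sym R-irr = record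
  { adj     = λ x y → does (R? x y)
  ; adj-sym = does-sym
  ; adj-irr = λ x → dec-false (R? x x) (R-irr x)
  }
  where
  does-sym : ∀ x y → does (R? x y) ≡ does (R? y x)
  does-sym x y with R? x y
  ... | yes r = sym (dec-true (R? y x) (R-sym r))
  ... | no ¬r = sym (dec-false (R? y x) (¬r ∘ R-sym))

adj-graphOf : {R : Fin n → Fin n → Set} (R? : ∀ x y → Dec (R x y))
              (R-sym : ∀ {x y} → R x y → R y x) (R-irr : ∀ x → ¬ R x x) →
              ∀ x y → adj (graphOf R? R-sym R-irr) x y ≡ true ⇔ R x y
adj-graphOf R? _ _ x y with R? x y
... | yes r = mk⇔ (λ _ → r) (λ _ → refl)
... | no ¬r = mk⇔ (λ ()) (λ r → contradiction r ¬r)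

completeGraph : ∀ n → Graph n
completeGraph n = graphOf (λ x y → ¬? (x ≟ y)) (_∘ sym) (λ x x≢x → x≢x refl)

adj-completeGraph : IsComplete (completeGraph n)
adj-completeGraph = adj-graphOf (λ x y → ¬? (x ≟ y)) (_∘ sym) (λ x x≢x → x≢x refl)

edgelessGraph : ∀ n → Graph n
edgelessGraph n = record { adj = λ _ _ → false ; adj-sym = λ _ _ → refl ; adj-irr = λ _ → refl }

module _ (M : PerfectMatching n) where

  NotPartners : Fin n → Fin n → Set
  NotPartners x y = x ≢ y × y ≢ partner M x

  notPartners? : ∀ x y → Dec (NotPartners x y)
  notPartners? x y = ¬? (x ≟ y) ×-dec ¬? (y ≟ partner M x)

  NotPartners-sym : ∀ {x y} → NotPartners x y → NotPartners y x
  NotPartners-sym {x} {y} (x≢y , y≢σx) =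
    x≢y ∘ sym , λ x≡σy → y≢σx (trans (sym (partner-involutive M y)) (cong (partner M) (sym x≡σy)))

  completeMinus : Graph n
  completeMinus = graphOf notPartners? NotPartners-sym (λ x (x≢x , _) → x≢x refl)

  adj-completeMinus : ∀ x y → adj completeMinus x y ≡ true ⇔ NotPartners x y
  adj-completeMinus = adj-graphOf notPartners? NotPartners-sym (λ x (x≢x , _) → x≢x refl)

  completeMinus-IsJoinOfPairs : IsJoinOfPairs completeMinus
  completeMinus-IsJoinOfPairs = partner M , partner-involutive M , partner-≢ M , adj-completeMinus

matchingOf : {G : Graph n} → IsJoinOfPairs G → PerfectMatching n
matchingOf (σ , σ-involutive , σ-≢ , _) =
  record { partner = σ ; partner-involutive = σ-involutive ; partner-≢ = σ-≢ }

⇔-true⇒≡ : {a b : Bool} → (a ≡ true ⇔ b ≡ true) → a ≡ b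
⇔-true⇒≡ {true}          a⇔b = sym (Equivalence.to a⇔b refl)
⇔-true⇒≡ {false} {false} _   = refl
⇔-true⇒≡ {false} {true}  a⇔b = Equivalence.from a⇔b refl

IsJoinOfPairs⇒≈completeMinus : {G : Graph n} (J : IsJoinOfPairs G) {M : PerfectMatching n} →
                               partner (matchingOf {G = G} J) ≗ partner M → G ≈G completeMinus M
IsJoinOfPairs⇒≈completeMinus (σ , _ , _ , adjacency) {M} σ≗M x y = ⇔-true⇒≡ (mk⇔
  (λ xy → let x≢y , y≢σx = Equivalence.to (adjacency x y) xy in
          Equivalence.from (adj-completeMinus M x y) (x≢y , λ y≡Mx → y≢σx (trans y≡Mx (sym (σ≗M x)))))
  (λ xy → let x≢y , y≢Mx = Equivalence.to (adj-completeMinus M x y) xy in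
          Equivalence.from (adjacency x y) (x≢y , λ y≡σx → y≢Mx (trans y≡σx (σ≗M x)))))

completeMinus-injective : {M M′ : PerfectMatching n} → completeMinus M ≈G completeMinus M′ → partner M ≗ partner M′
completeMinus-injective {M = M} {M′} K-M≈K-M′ x with partner M x ≟ partner M′ x
... | yes Mx≡M′x = Mx≡M′x
... | no  Mx≢M′x = contradiction (trans (sym K-M[x,Mx]) (trans (K-M≈K-M′ x (partner M x)) K-M′[x,Mx])) λ ()
  where
  K-M[x,Mx] : adj (completeMinus M) x (partner M x) ≡ false
  K-M[x,Mx] = dec-false (notPartners? M x (partner M x)) λ (_ , Mx≢Mx) → Mx≢Mx refl
  K-M′[x,Mx] : adj (completeMinus M′) x (partner M x) ≡ true
  K-M′[x,Mx] = Equivalence.from (adj-completeMinus M′ x (partner M x)) (partner-≢ M x ∘ sym , Mx≢M′x)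

exactlyJoinsOfPairs : ∀ q → Fin (q * 2) → ExactlyGraphs {q * 2} (perfectMatchingCount q) (λ G → 𝒰 2 ≡Fam 𝒟 G)
exactlyJoinsOfPairs q v =
  map completeMinus (perfectMatchings q) ,
  trans (length-map completeMinus (perfectMatchings q)) (length-perfectMatchings q) ,
  All.map⁺ {f = completeMinus}
    (All.universal (λ M → 𝒰₂≡𝒟 (completeMinus M) (completeMinus-IsJoinOfPairs M)) (perfectMatchings q)) ,
  AllPairs.map⁺ {f = completeMinus}
    (AllPairs.map (λ {M} {M′} M≉M′ → M≉M′ ∘ completeMinus-injective {M = M} {M′}) (perfectMatchings-distinct q)) ,
  λ G 𝒰≡𝒟 → let J = Equivalence.to (𝒰₂≡𝒟⇔IsJoinOfPairs v G) 𝒰≡𝒟 in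
    Any.map⁺ {f = completeMinus} (Any.map (λ {M} → IsJoinOfPairs⇒≈completeMinus {G = G} J {M})
                                          (perfectMatchings-complete q (matchingOf {G = G} J)))
  where
  𝒰₂≡𝒟 : (G : Graph (q * 2)) → IsJoinOfPairs G → 𝒰 2 ≡Fam 𝒟 G
  𝒰₂≡𝒟 G = Equivalence.from (𝒰₂≡𝒟⇔IsJoinOfPairs v G)

perfectMatchingCount-closedForm : ∀ q → perfectMatchingCount q * (2 ^ q * q !) ≡ (2 * q) !
perfectMatchingCount-closedForm zero    = refl
perfectMatchingCount-closedForm (suc q) = begin
  suc (q * 2) * c * (2 * 2 ^ q * (suc q * q !))
    ≡⟨ rearrange q c (2 ^ q) (q !) ⟩
  suc (suc (2 * q)) * (suc (2 * q) * (c * (2 ^ q * q !)))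
    ≡⟨ cong (λ m → suc (suc (2 * q)) * (suc (2 * q) * m)) (perfectMatchingCount-closedForm q) ⟩
  suc (suc (2 * q)) !
    ≡⟨ cong _! (*-suc 2 q) ⟨
  (2 * suc q) ! ∎
  where
  c : ℕ
  c = perfectMatchingCount q
  rearrange : ∀ a b p f →
              suc (a * 2) * b * (2 * p * (suc a * f)) ≡ suc (suc (2 * a)) * (suc (2 * a) * (b * (p * f)))
  rearrange = solve-∀

𝒰-IsDominationHypergraph⇔ : ∀ n r → 1 ≤ r → r ≤ n →
                            IsDominationHypergraph {n} (𝒰 r) ⇔ (r ≡ 1 ⊎ r ≡ n ⊎ (r ≡ 2 × 2 ∣ n))
𝒰-IsDominationHypergraph⇔ zero    r 1≤r r≤0 = contradiction (≤-trans 1≤r r≤0) λ ()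
𝒰-IsDominationHypergraph⇔ (suc n) r 1≤r r≤n = mk⇔ (classify r 1≤r r≤n) (realise r)
  where
  classify : ∀ r → 1 ≤ r → r ≤ suc n → IsDominationHypergraph (𝒰 r) → r ≡ 1 ⊎ r ≡ suc n ⊎ (r ≡ 2 × 2 ∣ suc n)
  classify 1 _ _ _ = inj₁ refl
  classify 2 _ _ (G , 𝒰≡𝒟) = inj₂ (inj₂ (refl ,
    PerfectMatching⇒even (matchingOf {G = G} (Equivalence.to (𝒰₂≡𝒟⇔IsJoinOfPairs zero G) 𝒰≡𝒟))))
  classify (suc (suc (suc j))) _ r≤n (G , 𝒰≡𝒟) with suc (suc (suc j)) ≟ℕ suc n
  ... | yes r≡n = inj₂ (inj₁ r≡n)
  ... | no  r≢n = contradiction 𝒰≡𝒟 (¬𝒰₃₊ⱼ≡𝒟 G j (≤∧≢⇒< r≤n r≢n))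
  realise : ∀ r → r ≡ 1 ⊎ r ≡ suc n ⊎ (r ≡ 2 × 2 ∣ suc n) → IsDominationHypergraph (𝒰 r)
  realise _ (inj₁ refl) =
    completeGraph (suc n) , Equivalence.from (𝒰₁≡𝒟⇔IsComplete zero (completeGraph (suc n))) adj-completeGraph
  realise _ (inj₂ (inj₁ refl)) =
    edgelessGraph (suc n) , Equivalence.from (𝒰ₙ≡𝒟⇔IsEdgeless (edgelessGraph (suc n))) λ _ _ → refl
  realise _ (inj₂ (inj₂ (refl , divides q n≡q*2))) = subst (λ m → IsDominationHypergraph {m} (𝒰 2)) (sym n≡q*2)
    (completeMinus M , Equivalence.from (𝒰₂≡𝒟⇔IsJoinOfPairs (subst Fin n≡q*2 zero) (completeMinus M))
                                        (completeMinus-IsJoinOfPairs M))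
    where
    M : PerfectMatching (q * 2)
    M = adjacentPairs q

proposition2p6 :
    (∀ (n r : ℕ) → 1 ≤ r → r ≤ n →
      (IsDominationHypergraph {n} (𝒰 r) ⇔ (r ≡ 1 ⊎ r ≡ n ⊎ (r ≡ 2 × 2 ∣ n))))
    × (∀ (n : ℕ) → 1 ≤ n → ∀ (G : Graph n) → ((𝒰 1 ≡Fam 𝒟 G) ⇔ IsComplete G))
    × (∀ (n : ℕ) → 1 ≤ n → ∀ (G : Graph n) → ((𝒰 n ≡Fam 𝒟 G) ⇔ IsEdgeless G))
    × (∀ (m : ℕ) → 1 ≤ m →
        (∀ (G : Graph (2 * m)) → ((𝒰 2 ≡Fam 𝒟 G) ⇔ IsJoinOfPairs G))
        × Σ ℕ (λ k → (k * (2 ^ m * m !) ≡ (2 * m) !)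
                     × ExactlyGraphs {2 * m} k (λ G → 𝒰 2 ≡Fam 𝒟 G)))
proposition2p6 =
  𝒰-IsDominationHypergraph⇔ ,
  (λ { (suc n) _ → 𝒰₁≡𝒟⇔IsComplete zero }) ,
  (λ _ _ → 𝒰ₙ≡𝒟⇔IsEdgeless) ,
  λ { (suc m) _ →
        𝒰₂≡𝒟⇔IsJoinOfPairs zero ,
        perfectMatchingCount (suc m) ,
        perfectMatchingCount-closedForm (suc m) ,
        subst (λ n → ExactlyGraphs {n} (perfectMatchingCount (suc m)) (λ G → 𝒰 2 ≡Fam 𝒟 G))
              (*-comm (suc m) 2) (exactlyJoinsOfPairs (suc m) zero) }
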